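{- Let $n\ge 2$ be an integer and $N$ an even non-negative integer. Then $N$ has a potentially connected graphical partition with exactly $n$ parts if and only if $N$ has a forcibly connected graphical partition with exactly $n$ parts.
   Context: A partition of $N$ with $n$ parts is a non-increasing sequence of $n$ positive integers summing to $N$. It is a graphical partition if it is the degree sequence of some simple graph (a realization). A graphical partition is potentially connected if at least one of its realizations is connected, and forcibly connected if all of its realizations are connected. -}

module Defs where

open import Data.Nat using (ℕ; zero; suc; _+_; _≥_; _≤_)
open import Data.Bool using (Bool; true; false)
open import Data.Fin using (Fin)
import Data.Fin as Fin
open import Data.Vec using (Vec; lookup; sum; countᵇ; tabulate)
open import Data.Product using (Σ; _×_; ∃)
open import Relation.Binary.PropositionalEquality using (_≡_; _≢_)
open import Relation.Nullary using (¬_)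

record SimpleGraph (n : ℕ) : Set where
  field
    adj   : Fin n → Fin n → Bool
    sym   : ∀ i j → adj i j ≡ adj j i
    irref : ∀ i → adj i i ≡ false
open SimpleGraph public

degree : ∀ {n} → SimpleGraph n → Fin n → ℕ
degree G i = countᵇ (λ b → b) (tabulate (adj G i))

data Walk {n} (G : SimpleGraph n) : Fin n → Fin n → Set where
  here : ∀ {i} → Walk G i i
  step : ∀ {i j k} → adj G i j ≡ true → Walk G j k → Walk G i k

Connected : ∀ {n} → SimpleGraph n → Set
Connected G = ∀ i j → Walk G i j

record IsPartition (N n : ℕ) (p : Vec ℕ n) : Set where
  field
    positive    : ∀ i → lookup p i ≥ 1
    nonincr     : ∀ (i j : Fin n) → i Fin.≤ j → lookup p j ≤ lookup p i
    sums        : sum p ≡ N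

Realizes : ∀ {n} → SimpleGraph n → Vec ℕ n → Set
Realizes G p = ∀ i → degree G i ≡ lookup p i

Graphical : ∀ {n} → Vec ℕ n → Set
Graphical {n} p = Σ (SimpleGraph n) λ G → Realizes G p

GraphicalPartition : (N n : ℕ) → Vec ℕ n → Set
GraphicalPartition N n p = IsPartition N n p × Graphical p

PotentiallyConnected : ∀ {n} → Vec ℕ n → Set
PotentiallyConnected {n} p = Σ (SimpleGraph n) λ G → Realizes G p × Connected G

ForciblyConnected : ∀ {n} → Vec ℕ n → Set
ForciblyConnected {n} p = ∀ (G : SimpleGraph n) → Realizes G p → Connected G

-- A realization with a dominating vertex is connected, so it suffices to find,
-- for every degree sum 2k realized by some connected graph on n vertices, a
-- sorted degree sequence with sum 2k whose first entry is n - 1. Contracting a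
-- vertex into a neighbour keeps a graph connected and lowers its degree sum by
-- at least 2, so connected graphs have k ≥ n - 1 edges; trivially k ≤ n(n-1)/2.
-- In this range a threshold graph does the job: a dominating vertex on top of
-- a graph with k - (n - 1) edges, built recursively from dominating vertices
-- and a final star.
module Submission where

open import Data.Nat using (ℕ; _≤_; _*_)
open import Data.Vec using (Vec)
open import Data.Product using (Σ; _×_; ∃)
open import Relation.Binary.PropositionalEquality using (_≡_)
open import Function.Bundles using (_⇔_)

open import Data.Bool using (Bool; true; false; not; _∧_; _∨_)
open import Data.Bool.Properties using (∨-comm; ∨-zeroʳ)
open import Data.Empty using (⊥; ⊥-elim)
open import Data.Fin as Fin using (Fin; zero; suc; toℕ)
open import Data.Fin.Properties using (_≟_)
open import Data.Nat using (zero; suc; _+_; _∸_; _<_; pred; z≤n; s≤s; _≤?_; _<ᵇ_)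
open import Data.Nat.Properties hiding (_≟_)
open import Data.Nat.Solver using (module +-*-Solver)
open import Data.Product using (_,_; proj₂)
open import Data.Sum as Sum using (_⊎_; inj₁; inj₂)
open import Data.Vec using ([]; _∷_; lookup; sum; countᵇ; tabulate)
open import Data.Vec.Properties using (lookup∘tabulate)
open import Function using (_∘_)
open import Function.Bundles using (mk⇔)
open import Relation.Binary.PropositionalEquality
  using (refl; sym; trans; cong; cong₂; subst; subst₂; _≢_; module ≡-Reasoning)
open import Relation.Nullary using (yes; no; contradiction)
open import Relation.Nullary.Decidable using (does; dec-true)
open import Defs hiding (sym)
open import Algebra.Properties.CommutativeMonoid.Sum +-0-commutativeMonoid
  using (sum-syntax; ∑-distrib-+; ∑-comm; sum-cong-≗; sum-replicate-zero)

open +-*-Solver using (solve; _:+_; _:*_; _:=_; con)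

⟦_⟧ : Bool → ℕ
⟦ true ⟧ = 1
⟦ false ⟧ = 0

⟦⟧≤1 : ∀ b → ⟦ b ⟧ ≤ 1
⟦⟧≤1 true = ≤-refl
⟦⟧≤1 false = z≤n

⟦∧⟧≤ʳ : ∀ a b → ⟦ a ∧ b ⟧ ≤ ⟦ b ⟧
⟦∧⟧≤ʳ true b = ≤-refl
⟦∧⟧≤ʳ false b = z≤n

⟦∨⟧≤ : ∀ a b → ⟦ a ∨ b ⟧ ≤ ⟦ a ⟧ + ⟦ b ⟧
⟦∨⟧≤ true b = s≤s z≤n
⟦∨⟧≤ false b = ≤-refl

∑-const : ∀ n c → ∑[ i < n ] c ≡ n * c
∑-const zero c = refl
∑-const (suc n) c = cong (c +_) (∑-const n c)

∑-ones : ∀ n → ∑[ i < n ] 1 ≡ n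
∑-ones n = trans (∑-const n 1) (*-identityʳ n)

∑-mono-≤ : ∀ {n} {f g : Fin n → ℕ} → (∀ i → f i ≤ g i) → ∑[ i < n ] f i ≤ ∑[ i < n ] g i
∑-mono-≤ {zero} f≤g = z≤n
∑-mono-≤ {suc n} f≤g = +-mono-≤ (f≤g zero) (∑-mono-≤ (f≤g ∘ suc))

∑-mono-< : ∀ {n} {f g : Fin n → ℕ} (v : Fin n) → (∀ i → f i ≤ g i) → f v < g v →
  ∑[ i < n ] f i < ∑[ i < n ] g i
∑-mono-< zero f≤g fv<gv = +-mono-<-≤ fv<gv (∑-mono-≤ (f≤g ∘ suc))
∑-mono-< (suc v) f≤g fv<gv = +-mono-≤-< (f≤g zero) (∑-mono-< v (f≤g ∘ suc) fv<gv)

∑∑-distrib-+ : ∀ {m n} (f g : Fin m → Fin n → ℕ) →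
  ∑[ i < m ] ∑[ j < n ] (f i j + g i j)
    ≡ ∑[ i < m ] ∑[ j < n ] f i j + ∑[ i < m ] ∑[ j < n ] g i j
∑∑-distrib-+ {n = n} f g = trans (sum-cong-≗ (λ i → ∑-distrib-+ (f i) (g i)))
  (∑-distrib-+ (λ i → ∑[ j < n ] f i j) (λ i → ∑[ j < n ] g i j))

count-< : ∀ {n} (f : Fin n → Bool) v → f v ≡ false → ∑[ i < n ] ⟦ f i ⟧ < n
count-< {n} f v fv = begin-strict
    ∑[ i < n ] ⟦ f i ⟧
  <⟨ ∑-mono-< v (⟦⟧≤1 ∘ f) (subst (λ b → ⟦ b ⟧ < 1) (sym fv) (s≤s z≤n)) ⟩
    ∑[ i < n ] 1
  ≡⟨ ∑-ones n ⟩
    n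
  ∎
  where open ≤-Reasoning

count≡n⇒true : ∀ {n} (f : Fin n → Bool) → ∑[ i < n ] ⟦ f i ⟧ ≡ n → ∀ i → f i ≡ true
count≡n⇒true f total i with f i in fi
... | true = refl
... | false = contradiction total (<⇒≢ (count-< f i fi))

count-pos : ∀ {n} (f : Fin n → Bool) v → f v ≡ true → 1 ≤ ∑[ i < n ] ⟦ f i ⟧
count-pos f zero fv rewrite fv = s≤s z≤n
count-pos f (suc v) fv = ≤-trans (count-pos (f ∘ suc) v fv) (m≤n+m _ ⟦ f zero ⟧)

count-point : ∀ {n} (u : Fin n) b → ∑[ j < n ] ⟦ does (j ≟ u) ∧ b ⟧ ≡ ⟦ b ⟧
count-point {suc n} zero b = trans (cong (⟦ b ⟧ +_) (sum-replicate-zero n)) (+-identityʳ ⟦ b ⟧)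
count-point {suc n} (suc u) b = count-point u b

count-below : ∀ {n} e → e ≤ n → ∑[ j < n ] ⟦ toℕ j <ᵇ e ⟧ ≡ e
count-below {zero} zero z≤n = refl
count-below {suc n} zero z≤n = sum-replicate-zero n
count-below {suc n} (suc e) (s≤s e≤n) = cong suc (count-below e e≤n)

<ᵇ-antitone : ∀ {a b} e → a ≤ b → ⟦ b <ᵇ e ⟧ ≤ ⟦ a <ᵇ e ⟧
<ᵇ-antitone zero a≤b = z≤n
<ᵇ-antitone {b = b} (suc e) z≤n = ⟦⟧≤1 (b <ᵇ suc e)
<ᵇ-antitone (suc e) (s≤s a≤b) = <ᵇ-antitone e a≤b

no-loop : ∀ {n} (G : SimpleGraph n) {i} → adj G i i ≡ true → ⊥
no-loop G {i} loop with trans (sym loop) (irref G i)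
... | ()

countᵇ-tabulate : ∀ {n} (f : Fin n → Bool) → countᵇ (λ b → b) (tabulate f) ≡ ∑[ i < n ] ⟦ f i ⟧
countᵇ-tabulate {zero} f = refl
countᵇ-tabulate {suc n} f with f zero
... | true = cong suc (countᵇ-tabulate (f ∘ suc))
... | false = countᵇ-tabulate (f ∘ suc)

degree≡∑ : ∀ {n} (G : SimpleGraph n) i → degree G i ≡ ∑[ j < n ] ⟦ adj G i j ⟧
degree≡∑ G i = countᵇ-tabulate (adj G i)

degreeSum : ∀ {n} → SimpleGraph n → ℕ
degreeSum {n} G = ∑[ i < n ] degree G i

degreeSum≡∑∑ : ∀ {n} (G : SimpleGraph n) → degreeSum G ≡ ∑[ i < n ] ∑[ j < n ] ⟦ adj G i j ⟧
degreeSum≡∑∑ G = sum-cong-≗ (degree≡∑ G)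

degree<n : ∀ {n} (G : SimpleGraph n) i → degree G i < n
degree<n G i rewrite degree≡∑ G i = count-< (adj G i) i (irref G i)

adjacent⇒1≤degree : ∀ {n} (G : SimpleGraph n) {i j} → adj G i j ≡ true → 1 ≤ degree G i
adjacent⇒1≤degree G {i} {j} e rewrite degree≡∑ G i = count-pos (adj G i) j e

maxEdges : ℕ → ℕ
maxEdges zero = 0
maxEdges (suc n) = n + maxEdges n

2*maxEdges : ∀ n → 2 * maxEdges n ≡ n * pred n
2*maxEdges zero = refl
2*maxEdges (suc zero) = refl
2*maxEdges (suc (suc n)) = begin
    2 * (suc n + maxEdges (suc n))
  ≡⟨ *-distribˡ-+ 2 (suc n) (maxEdges (suc n)) ⟩
    2 * suc n + 2 * maxEdges (suc n)
  ≡⟨ cong (2 * suc n +_) (2*maxEdges (suc n)) ⟩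
    2 * suc n + suc n * n
  ≡⟨ solve 1 (λ n → con 2 :* (con 1 :+ n) :+ (con 1 :+ n) :* n := (con 2 :+ n) :* (con 1 :+ n))
           refl n ⟩
    suc (suc n) * suc n
  ∎
  where open ≡-Reasoning

degreeSum≤ : ∀ {n} (G : SimpleGraph n) → degreeSum G ≤ 2 * maxEdges n
degreeSum≤ {n} G = begin
    degreeSum G
  ≤⟨ ∑-mono-≤ (λ i → <⇒≤pred (degree<n G i)) ⟩
    ∑[ i < n ] pred n
  ≡⟨ ∑-const n (pred n) ⟩
    n * pred n
  ≡⟨ sym (2*maxEdges n) ⟩
    2 * maxEdges n
  ∎
  where open ≤-Reasoning

step-out : ∀ {n} {G : SimpleGraph n} {i j} → Walk G i j → i ≢ j → ∃ λ k → adj G i k ≡ true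
step-out here i≢i = contradiction refl i≢i
step-out (step e _) _ = _ , e

connected⇒1≤degree : ∀ {m} (G : SimpleGraph (suc (suc m))) → Connected G → ∀ i → 1 ≤ degree G i
connected⇒1≤degree G conn zero =
  adjacent⇒1≤degree G (proj₂ (step-out (conn zero (suc zero)) λ ()))
connected⇒1≤degree G conn (suc i) =
  adjacent⇒1≤degree G (proj₂ (step-out (conn (suc i) zero) λ ()))

full-degree⇒dominating : ∀ {m} (G : SimpleGraph (suc m)) → degree G zero ≡ m →
  ∀ j → adj G zero (suc j) ≡ true
full-degree⇒dominating {m} G full = count≡n⇒true (λ j → adj G zero (suc j)) (begin
    ∑[ j < m ] ⟦ adj G zero (suc j) ⟧
  ≡⟨ cong (λ b → ⟦ b ⟧ + ∑[ j < m ] ⟦ adj G zero (suc j) ⟧) (irref G zero) ⟨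
    ∑[ j < suc m ] ⟦ adj G zero j ⟧
  ≡⟨ degree≡∑ G zero ⟨
    degree G zero
  ≡⟨ full ⟩
    m
  ∎)
  where open ≡-Reasoning

dominating⇒connected : ∀ {m} (G : SimpleGraph (suc m)) → (∀ j → adj G zero (suc j) ≡ true) →
  Connected G
dominating⇒connected G dom i j = to-zero i
  where
  from-zero : ∀ j → Walk G zero j
  from-zero zero = here
  from-zero (suc j) = step (dom j) here
  to-zero : ∀ i → Walk G i j
  to-zero zero = from-zero j
  to-zero (suc i) = step (trans (SimpleGraph.sym G (suc i) zero) (dom i)) (from-zero j)

-- Vertex zero is merged into u, which inherits the other neighbours of zero.
module Contraction {m} (G : SimpleGraph (suc (suc m))) (u : Fin (suc m)) where

  restAdj : Fin (suc m) → Fin (suc m) → Bool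
  restAdj i j = adj G (suc i) (suc j)

  neighbours others : Fin (suc m) → Bool
  neighbours j = adj G zero (suc j)
  others j = not (does (j ≟ u)) ∧ neighbours j

  inherited : Fin (suc m) → Fin (suc m) → Bool
  inherited i j = does (i ≟ u) ∧ others j

  contractedAdj : Fin (suc m) → Fin (suc m) → Bool
  contractedAdj i j = restAdj i j ∨ (inherited i j ∨ inherited j i)

  contractedAdj-sym : ∀ i j → contractedAdj i j ≡ contractedAdj j i
  contractedAdj-sym i j
    rewrite SimpleGraph.sym G (suc i) (suc j) | ∨-comm (inherited i j) (inherited j i) = refl

  contractedAdj-irref : ∀ i → contractedAdj i i ≡ false
  contractedAdj-irref i rewrite irref G (suc i) with does (i ≟ u)
  ... | true = refl
  ... | false = refl

  contracted : SimpleGraph (suc m)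
  contracted = record
    { adj = contractedAdj ; sym = contractedAdj-sym ; irref = contractedAdj-irref }

  merge : Fin (suc (suc m)) → Fin (suc m)
  merge zero = u
  merge (suc j) = j

  joined-to-u : ∀ j → adj G zero (suc j) ≡ true → u ≡ j ⊎ contractedAdj u j ≡ true
  joined-to-u j e with j ≟ u
  ... | yes refl = inj₁ refl
  ... | no _ rewrite dec-true (u ≟ u) refl | e = inj₂ (∨-zeroʳ _)

  merge-edge : ∀ {a b} → adj G a b ≡ true →
    merge a ≡ merge b ⊎ contractedAdj (merge a) (merge b) ≡ true
  merge-edge {zero} {zero} e = ⊥-elim (no-loop G e)
  merge-edge {zero} {suc b} e = joined-to-u b e
  merge-edge {suc a} {zero} e =
    Sum.map sym (trans (contractedAdj-sym a u))
      (joined-to-u a (trans (SimpleGraph.sym G zero (suc a)) e))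
  merge-edge {suc a} {suc b} e = inj₂ (cong (_∨ (inherited a b ∨ inherited b a)) e)

  merge-walk : ∀ {a b} → Walk G a b → Walk contracted (merge a) (merge b)
  merge-walk here = here
  merge-walk (step e w) with merge-edge e
  ... | inj₁ same rewrite same = merge-walk w
  ... | inj₂ e′ = step e′ (merge-walk w)

  contracted-connected : Connected G → Connected contracted
  contracted-connected conn i j = merge-walk (conn (suc i) (suc j))

  #neighbours #others restDegreeSum : ℕ
  #neighbours = ∑[ j < suc m ] ⟦ neighbours j ⟧
  #others = ∑[ j < suc m ] ⟦ others j ⟧
  restDegreeSum = ∑[ i < suc m ] ∑[ j < suc m ] ⟦ restAdj i j ⟧

  degreeSum-G : degreeSum G ≡ #neighbours + (#neighbours + restDegreeSum)
  degreeSum-G = begin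
      degreeSum G
    ≡⟨ degreeSum≡∑∑ G ⟩
      (⟦ adj G zero zero ⟧ + #neighbours)
        + ∑[ i < suc m ] (⟦ adj G (suc i) zero ⟧ + ∑[ j < suc m ] ⟦ restAdj i j ⟧)
    ≡⟨ cong₂ _+_ (cong (λ b → ⟦ b ⟧ + #neighbours) (irref G zero))
                 (∑-distrib-+ (λ i → ⟦ adj G (suc i) zero ⟧) (λ i → ∑[ j < suc m ] ⟦ restAdj i j ⟧)) ⟩
      #neighbours + (∑[ i < suc m ] ⟦ adj G (suc i) zero ⟧ + restDegreeSum)
    ≡⟨ cong (λ s → #neighbours + (s + restDegreeSum))
            (sum-cong-≗ (λ i → cong ⟦_⟧ (SimpleGraph.sym G (suc i) zero))) ⟩
      #neighbours + (#neighbours + restDegreeSum)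
    ∎
    where open ≡-Reasoning

  count-inherited : ∑[ i < suc m ] ∑[ j < suc m ] ⟦ inherited i j ⟧ ≡ #others
  count-inherited = begin
      ∑[ i < suc m ] ∑[ j < suc m ] ⟦ inherited i j ⟧
    ≡⟨ ∑-comm (λ i j → ⟦ inherited i j ⟧) ⟩
      ∑[ j < suc m ] ∑[ i < suc m ] ⟦ inherited i j ⟧
    ≡⟨ sum-cong-≗ (λ j → count-point u (others j)) ⟩
      #others
    ∎
    where open ≡-Reasoning

  count-inherited-swap : ∑[ i < suc m ] ∑[ j < suc m ] ⟦ inherited j i ⟧ ≡ #others
  count-inherited-swap = sum-cong-≗ (λ i → count-point u (others i))

  degreeSum-contracted : degreeSum contracted ≤ restDegreeSum + (#others + #others)
  degreeSum-contracted = begin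
      degreeSum contracted
    ≡⟨ degreeSum≡∑∑ contracted ⟩
      ∑[ i < suc m ] ∑[ j < suc m ] ⟦ contractedAdj i j ⟧
    ≤⟨ ∑-mono-≤ (λ i → ∑-mono-≤ (λ j → split-∨ i j)) ⟩
      ∑[ i < suc m ] ∑[ j < suc m ] (⟦ restAdj i j ⟧ + (⟦ inherited i j ⟧ + ⟦ inherited j i ⟧))
    ≡⟨ ∑∑-distrib-+ (λ i j → ⟦ restAdj i j ⟧) (λ i j → ⟦ inherited i j ⟧ + ⟦ inherited j i ⟧) ⟩
      restDegreeSum + ∑[ i < suc m ] ∑[ j < suc m ] (⟦ inherited i j ⟧ + ⟦ inherited j i ⟧)
    ≡⟨ cong (restDegreeSum +_) (∑∑-distrib-+ (λ i j → ⟦ inherited i j ⟧) (λ i j → ⟦ inherited j i ⟧)) ⟩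
      restDegreeSum + (∑[ i < suc m ] ∑[ j < suc m ] ⟦ inherited i j ⟧
                        + ∑[ i < suc m ] ∑[ j < suc m ] ⟦ inherited j i ⟧)
    ≡⟨ cong (restDegreeSum +_) (cong₂ _+_ count-inherited count-inherited-swap) ⟩
      restDegreeSum + (#others + #others)
    ∎
    where
    open ≤-Reasoning
    split-∨ : ∀ i j →
      ⟦ contractedAdj i j ⟧ ≤ ⟦ restAdj i j ⟧ + (⟦ inherited i j ⟧ + ⟦ inherited j i ⟧)
    split-∨ i j = ≤-trans (⟦∨⟧≤ (restAdj i j) _)
      (+-monoʳ-≤ ⟦ restAdj i j ⟧ (⟦∨⟧≤ (inherited i j) (inherited j i)))

  #others<#neighbours : neighbours u ≡ true → #others < #neighbours
  #others<#neighbours adjacent = ∑-mono-< u (λ j → ⟦∧⟧≤ʳ (not (does (j ≟ u))) (neighbours j)) at-u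
    where
    at-u : ⟦ others u ⟧ < ⟦ neighbours u ⟧
    at-u rewrite dec-true (u ≟ u) refl | adjacent = s≤s z≤n

  degreeSum-drop : adj G zero (suc u) ≡ true → 2 + degreeSum contracted ≤ degreeSum G
  degreeSum-drop adjacent = begin
      2 + degreeSum contracted
    ≤⟨ +-monoʳ-≤ 2 degreeSum-contracted ⟩
      2 + (restDegreeSum + (#others + #others))
    ≡⟨ solve 2 (λ r y → con 2 :+ (r :+ (y :+ y)) := (con 1 :+ y) :+ ((con 1 :+ y) :+ r))
             refl restDegreeSum #others ⟩
      suc #others + (suc #others + restDegreeSum)
    ≤⟨ +-mono-≤ fewer (+-monoˡ-≤ restDegreeSum fewer) ⟩
      #neighbours + (#neighbours + restDegreeSum)
    ≡⟨ degreeSum-G ⟨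
      degreeSum G
    ∎
    where
    open ≤-Reasoning
    fewer = #others<#neighbours adjacent

connected⇒2m≤degreeSum : ∀ {m} (G : SimpleGraph (suc m)) → Connected G → 2 * m ≤ degreeSum G
connected⇒2m≤degreeSum {zero} G conn = z≤n
connected⇒2m≤degreeSum {suc m} G conn with step-out (conn zero (suc zero)) (λ ())
... | zero , loop = ⊥-elim (no-loop G loop)
... | suc u , e = begin
    2 * suc m
  ≡⟨ *-suc 2 m ⟩
    2 + 2 * m
  ≤⟨ +-monoʳ-≤ 2 (connected⇒2m≤degreeSum contracted (contracted-connected conn)) ⟩
    2 + degreeSum contracted
  ≤⟨ degreeSum-drop e ⟩
    degreeSum G
  ∎
  where
  open ≤-Reasoning
  open Contraction G u

DegreesNonIncreasing : ∀ {n} → SimpleGraph n → Set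
DegreesNonIncreasing {n} G = ∀ (i j : Fin n) → i Fin.≤ j → degree G j ≤ degree G i

degreeSequence : ∀ {n} → SimpleGraph n → Vec ℕ n
degreeSequence G = tabulate (degree G)

realizes-degreeSequence : ∀ {n} (G : SimpleGraph n) → Realizes G (degreeSequence G)
realizes-degreeSequence G i = sym (lookup∘tabulate (degree G) i)

sum≡∑lookup : ∀ {n} (p : Vec ℕ n) → sum p ≡ ∑[ i < n ] lookup p i
sum≡∑lookup [] = refl
sum≡∑lookup (x ∷ p) = cong (x +_) (sum≡∑lookup p)

degreeSum-realizes : ∀ {n} (G : SimpleGraph n) (p : Vec ℕ n) → Realizes G p → degreeSum G ≡ sum p
degreeSum-realizes G p real = trans (sum-cong-≗ real) (sym (sum≡∑lookup p))

degreeSequence-isPartition : ∀ {n} (G : SimpleGraph n) → (∀ i → 1 ≤ degree G i) →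
  DegreesNonIncreasing G → IsPartition (degreeSum G) n (degreeSequence G)
degreeSequence-isPartition G positive nonIncreasing = record
  { positive = λ i → subst (1 ≤_) (real i) (positive i)
  ; nonincr = λ i j i≤j → subst₂ _≤_ (real j) (real i) (nonIncreasing i j i≤j)
  ; sums = sym (degreeSum-realizes G (degreeSequence G) real)
  }
  where real = realizes-degreeSequence G

addDominatingAdj : ∀ {n} → SimpleGraph n → Fin (suc n) → Fin (suc n) → Bool
addDominatingAdj G zero zero = false
addDominatingAdj G zero (suc j) = true
addDominatingAdj G (suc i) zero = true
addDominatingAdj G (suc i) (suc j) = adj G i j

addDominating : ∀ {n} → SimpleGraph n → SimpleGraph (suc n)
addDominating G = record { adj = addDominatingAdj G ; sym = symmetric ; irref = irreflexive }
  where
  symmetric : ∀ i j → addDominatingAdj G i j ≡ addDominatingAdj G j i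
  symmetric zero zero = refl
  symmetric zero (suc j) = refl
  symmetric (suc i) zero = refl
  symmetric (suc i) (suc j) = SimpleGraph.sym G i j
  irreflexive : ∀ i → addDominatingAdj G i i ≡ false
  irreflexive zero = refl
  irreflexive (suc i) = irref G i

degree-addDominating-zero : ∀ {n} (G : SimpleGraph n) → degree (addDominating G) zero ≡ n
degree-addDominating-zero {n} G = trans (degree≡∑ (addDominating G) zero) (∑-ones n)

degree-addDominating-suc : ∀ {n} (G : SimpleGraph n) i →
  degree (addDominating G) (suc i) ≡ suc (degree G i)
degree-addDominating-suc G i =
  trans (degree≡∑ (addDominating G) (suc i)) (cong suc (sym (degree≡∑ G i)))

degreeSum-addDominating : ∀ {n} (G : SimpleGraph n) →
  degreeSum (addDominating G) ≡ n + (n + degreeSum G)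
degreeSum-addDominating {n} G = begin
    degree (addDominating G) zero + ∑[ i < n ] degree (addDominating G) (suc i)
  ≡⟨ cong₂ _+_ (degree-addDominating-zero G) (sum-cong-≗ (degree-addDominating-suc G)) ⟩
    n + ∑[ i < n ] (1 + degree G i)
  ≡⟨ cong (n +_) (∑-distrib-+ (λ _ → 1) (degree G)) ⟩
    n + (∑[ i < n ] 1 + degreeSum G)
  ≡⟨ cong (λ s → n + (s + degreeSum G)) (∑-ones n) ⟩
    n + (n + degreeSum G)
  ∎
  where open ≡-Reasoning

addDominating-nonIncreasing : ∀ {n} (G : SimpleGraph n) → DegreesNonIncreasing G →
  DegreesNonIncreasing (addDominating G)
addDominating-nonIncreasing G nonIncreasing zero zero _ = ≤-refl
addDominating-nonIncreasing G nonIncreasing zero (suc j) _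
  rewrite degree-addDominating-suc G j | degree-addDominating-zero G = degree<n G j
addDominating-nonIncreasing G nonIncreasing (suc i) (suc j) (s≤s i≤j)
  rewrite degree-addDominating-suc G i | degree-addDominating-suc G j =
  s≤s (nonIncreasing i j i≤j)

starAdj : ∀ {m} → ℕ → Fin (suc m) → Fin (suc m) → Bool
starAdj e zero zero = false
starAdj e zero (suc j) = toℕ j <ᵇ e
starAdj e (suc i) zero = toℕ i <ᵇ e
starAdj e (suc i) (suc j) = false

star : ∀ m → ℕ → SimpleGraph (suc m)
star m e = record { adj = starAdj e ; sym = symmetric ; irref = irreflexive }
  where
  symmetric : ∀ i j → starAdj e i j ≡ starAdj e j i
  symmetric zero zero = refl
  symmetric zero (suc j) = refl
  symmetric (suc i) zero = refl
  symmetric (suc i) (suc j) = refl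
  irreflexive : ∀ i → starAdj e i i ≡ false
  irreflexive zero = refl
  irreflexive (suc i) = refl

degree-star-zero : ∀ {m e} → e ≤ m → degree (star m e) zero ≡ e
degree-star-zero {m} {e} e≤m = trans (degree≡∑ (star m e) zero) (count-below e e≤m)

degree-star-suc : ∀ m e j → degree (star m e) (suc j) ≡ ⟦ toℕ j <ᵇ e ⟧
degree-star-suc m e j = begin
    degree (star m e) (suc j)
  ≡⟨ degree≡∑ (star m e) (suc j) ⟩
    ⟦ toℕ j <ᵇ e ⟧ + ∑[ k < m ] 0
  ≡⟨ cong (⟦ toℕ j <ᵇ e ⟧ +_) (sum-replicate-zero m) ⟩
    ⟦ toℕ j <ᵇ e ⟧ + 0
  ≡⟨ +-identityʳ _ ⟩
    ⟦ toℕ j <ᵇ e ⟧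
  ∎
  where open ≡-Reasoning

degreeSum-star : ∀ {m e} → e ≤ m → degreeSum (star m e) ≡ 2 * e
degreeSum-star {m} {e} e≤m = begin
    degree (star m e) zero + ∑[ j < m ] degree (star m e) (suc j)
  ≡⟨ cong₂ _+_ (degree-star-zero e≤m) (sum-cong-≗ (degree-star-suc m e)) ⟩
    e + ∑[ j < m ] ⟦ toℕ j <ᵇ e ⟧
  ≡⟨ cong (e +_) (trans (count-below e e≤m) (sym (+-identityʳ e))) ⟩
    2 * e
  ∎
  where open ≡-Reasoning

star-nonIncreasing : ∀ {m e} → e ≤ m → DegreesNonIncreasing (star m e)
star-nonIncreasing e≤m zero zero _ = ≤-refl
star-nonIncreasing {m} {e} e≤m zero (suc j) _
  rewrite degree-star-suc m e j | degree-star-zero e≤m = leaf≤center e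
  where
  leaf≤center : ∀ e → ⟦ toℕ j <ᵇ e ⟧ ≤ e
  leaf≤center zero = z≤n
  leaf≤center (suc e) = ≤-trans (⟦⟧≤1 _) (s≤s z≤n)
star-nonIncreasing {m} {e} e≤m (suc i) (suc j) (s≤s i≤j)
  rewrite degree-star-suc m e i | degree-star-suc m e j = <ᵇ-antitone e i≤j

mutual
  threshold : ∀ n e → e ≤ maxEdges n →
    Σ (SimpleGraph n) λ G → degreeSum G ≡ 2 * e × DegreesNonIncreasing G
  threshold zero zero z≤n = record { adj = λ () ; sym = λ () ; irref = λ () } , refl , λ ()
  threshold (suc m) e e≤max with m ≤? e
  ... | yes m≤e =
    let G , degreeSum-G , nonIncreasing , _ = dominatedThreshold m e m≤e e≤max
    in G , degreeSum-G , nonIncreasing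
  ... | no m≰e = star m e , degreeSum-star e≤m , star-nonIncreasing e≤m
    where e≤m = <⇒≤ (≰⇒> m≰e)

  dominatedThreshold : ∀ m e → m ≤ e → e ≤ maxEdges (suc m) →
    Σ (SimpleGraph (suc m)) λ G → degreeSum G ≡ 2 * e × DegreesNonIncreasing G × degree G zero ≡ m
  dominatedThreshold m e m≤e e≤max
    with threshold m (e ∸ m) (≤-trans (∸-monoˡ-≤ m e≤max) (≤-reflexive (m+n∸m≡n m (maxEdges m))))
  ... | G , degreeSum-G , nonIncreasing =
      addDominating G
    , degreeSum-addDominating-G
    , addDominating-nonIncreasing G nonIncreasing
    , degree-addDominating-zero G
    where
    open ≡-Reasoning
    degreeSum-addDominating-G : degreeSum (addDominating G) ≡ 2 * e
    degreeSum-addDominating-G = begin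
        degreeSum (addDominating G)
      ≡⟨ degreeSum-addDominating G ⟩
        m + (m + degreeSum G)
      ≡⟨ cong (λ s → m + (m + s)) degreeSum-G ⟩
        m + (m + 2 * (e ∸ m))
      ≡⟨ solve 2 (λ m d → m :+ (m :+ con 2 :* d) := con 2 :* (m :+ d)) refl m (e ∸ m) ⟩
        2 * (m + (e ∸ m))
      ≡⟨ cong (2 *_) (m+[n∸m]≡n m≤e) ⟩
        2 * e
      ∎

forciblyConnectedPartition : ∀ m k → suc m ≤ k → k ≤ maxEdges (suc (suc m)) →
  Σ (Vec ℕ (suc (suc m))) λ p → GraphicalPartition (2 * k) (suc (suc m)) p × ForciblyConnected p
forciblyConnectedPartition m k lower upper with dominatedThreshold (suc m) k lower upper
... | H , degreeSum-H , nonIncreasing , full =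
  degreeSequence H , (partition , H , realizes-degreeSequence H) , forced
  where
  forced : ForciblyConnected (degreeSequence H)
  forced G real = dominating⇒connected G (full-degree⇒dominating G
    (trans (real zero) (trans (sym (realizes-degreeSequence H zero)) full)))
  positive : ∀ i → 1 ≤ degree H i
  positive = connected⇒1≤degree H (forced H (realizes-degreeSequence H))
  partition : IsPartition (2 * k) (suc (suc m)) (degreeSequence H)
  partition = subst (λ s → IsPartition s (suc (suc m)) (degreeSequence H)) degreeSum-H
    (degreeSequence-isPartition H positive nonIncreasing)

potentially⇒forcibly : ∀ m k →
  Σ (Vec ℕ (suc (suc m))) (λ p → GraphicalPartition (2 * k) (suc (suc m)) p × PotentiallyConnected p) →
  Σ (Vec ℕ (suc (suc m))) (λ p → GraphicalPartition (2 * k) (suc (suc m)) p × ForciblyConnected p)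
potentially⇒forcibly m k (p , (partition , _) , G , real , conn) =
  forciblyConnectedPartition m k lower upper
  where
  degreeSum-G : degreeSum G ≡ 2 * k
  degreeSum-G = trans (degreeSum-realizes G p real) (IsPartition.sums partition)
  lower : suc m ≤ k
  lower = *-cancelˡ-≤ 2 (subst (2 * suc m ≤_) degreeSum-G (connected⇒2m≤degreeSum G conn))
  upper : k ≤ maxEdges (suc (suc m))
  upper = *-cancelˡ-≤ 2 (subst (_≤ 2 * maxEdges (suc (suc m))) degreeSum-G (degreeSum≤ G))

forcibly⇒potentially : ∀ {n N} →
  Σ (Vec ℕ n) (λ p → GraphicalPartition N n p × ForciblyConnected p) →
  Σ (Vec ℕ n) (λ p → GraphicalPartition N n p × PotentiallyConnected p)
forcibly⇒potentially (p , (partition , G , real) , forced) =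
  p , (partition , G , real) , G , real , forced G real

proposition1 : (n N : ℕ) → 2 ≤ n → (Σ ℕ λ k → N ≡ 2 * k) →
    (Σ (Vec ℕ n) (λ p → GraphicalPartition N n p × PotentiallyConnected p))
    ⇔ (Σ (Vec ℕ n) (λ p → GraphicalPartition N n p × ForciblyConnected p))
proposition1 (suc (suc m)) _ _ (k , refl) = mk⇔ (potentially⇒forcibly m k) forcibly⇒potentially
proposition1 (suc zero) N (s≤s ()) _
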